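{- If $F\subseteq F^*$, then for every $F$-equilibrium $(p,f)$ we have $\mathrm{supp}(f)\subseteq F^*$.
   Context: Linear exchange market: agents $A=[n]$, goods $G=\{g_1,\dots,g_n\}$, one unit of each good, agent $i$ owns the unit of $g_i$; utilities $u_{ij}\ge0$; $E=\{(i,g_j): u_{ij}>0\}$. For prices $p>0$, $\mathrm{MBB}(p)$ is the set of $(i,g_j)\in E$ with $u_{ij}/p_j=\max_k u_{ik}/p_k$. For $F\subseteq E$, $(p,f)$ is an $F$-allocation if (i) $p>0$ and $f_{ij}\ge 0$ for $(i,g_j)\notin F$; (ii) $\mathrm{supp}(f)\cup F\subseteq \mathrm{MBB}(p)$; (iii) $\sum_j f_{ij}\le p_i$ for all $i\in A$; (iv) $\sum_i f_{ij}\le p_j$ for all $g_j$. Surplus of good $g_j$: $s_j(p,f)=p_j-\sum_i f_{ij}$. An $F$-equilibrium is an $F$-allocation with $\|s(p,f)\|_1=0$; a market equilibrium is an $\emptyset$-equilibrium. $F^*$ is the set of edges of $E$ lying in $\mathrm{MBB}(p)$ for every market equilibrium $(p,f)$.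
   Formalization: The utilities $u_{ij}$, prices $p$ and flows $f$ are rational, both in the $F$-equilibria considered and in the market equilibria that define $F^*$. -}

module Defs where

open import Data.Nat using (ℕ; zero; suc)
open import Data.Fin using (Fin; zero; suc)
open import Data.Rational using (ℚ; 0ℚ; _+_; _-_; _*_; _≤_; _<_; ∣_∣)
open import Data.Product using (_×_)
open import Data.Sum using (_⊎_)
open import Data.Empty using (⊥)
open import Relation.Nullary using (¬_)
open import Relation.Binary.PropositionalEquality using (_≡_; _≢_)

∑ : ∀ {n} → (Fin n → ℚ) → ℚ
∑ {zero}  g = 0ℚ
∑ {suc n} g = g zero + ∑ (λ k → g (suc k))

-- A linear exchange market with n agents and n goods; agent i owns good g_i.
-- Utilities u i j = u_{ij} ≥ 0.
Utilities : ℕ → Set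
Utilities n = Fin n → Fin n → ℚ

Edge : ∀ {n} → Utilities n → Fin n → Fin n → Set
Edge u i j = 0ℚ < u i j

EdgeSet : ℕ → Set₁
EdgeSet n = Fin n → Fin n → Set

Prices : ℕ → Set
Prices n = Fin n → ℚ

Flow : ℕ → Set
Flow n = Fin n → Fin n → ℚ

-- (i, g_j) ∈ MBB(p): (i,g_j) ∈ E and u_ij / p_j = max_k u_ik / p_k.
-- With all prices positive, u_ik / p_k ≤ u_ij / p_j is written
-- (cross-multiplied) as u_ik * p_j ≤ u_ij * p_k.
MBB : ∀ {n} → Utilities n → Prices n → Fin n → Fin n → Set
MBB u p i j = Edge u i j × (∀ k → u i k * p j ≤ u i j * p k)

IsFAllocation : ∀ {n} → Utilities n → EdgeSet n → Prices n → Flow n → Set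
IsFAllocation {n} u F p f =
  (∀ j → 0ℚ < p j) ×
  (∀ i j → ¬ F i j → 0ℚ ≤ f i j) ×
  (∀ i j → (f i j ≢ 0ℚ ⊎ F i j) → MBB u p i j) ×
  (∀ i → ∑ (λ j → f i j) ≤ p i) ×
  (∀ j → ∑ (λ i → f i j) ≤ p j)

surplus : ∀ {n} → Prices n → Flow n → Fin n → ℚ
surplus p f j = p j - ∑ (λ i → f i j)

IsFEquilibrium : ∀ {n} → Utilities n → EdgeSet n → Prices n → Flow n → Set
IsFEquilibrium u F p f =
  IsFAllocation u F p f × (∑ (λ j → ∣ surplus p f j ∣) ≡ 0ℚ)

∅E : ∀ {n} → EdgeSet n
∅E _ _ = ⊥

IsMarketEquilibrium : ∀ {n} → Utilities n → Prices n → Flow n → Set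
IsMarketEquilibrium u p f = IsFEquilibrium u ∅E p f

FStar : ∀ {n} → Utilities n → EdgeSet n
FStar {n} u i j =
  Edge u i j × ((p : Prices n) (f : Flow n) → IsMarketEquilibrium u p f → MBB u p i j)

-- Let (p, f) be an F-equilibrium, (q, g) a market equilibrium with F ⊆ MBB(q), and
-- suppose agent i₀ buys good j under f although some good l beats j for i₀ at prices q.
-- Then q_j / p_j exceeds the threshold c / a, where c = u_{i₀j} q_l and a = u_{i₀l} p_j;
-- let T be the set of goods whose ratio q / p exceeds it.  An agent with a q-MBB good in
-- T has all its p-MBB goods in T, and no q-MBB good of i₀ lies in T.  Hence, as F ⊆ MBB(q),
-- every agent either buys nothing in T under g and pays a non-negative amount for T
-- under f, or spends its whole budget p_i on T under f.  Either way
--   a·(g-spending on T) + c·[i ∈ T] p_i ≤ c·(f-spending on T) + a·[i ∈ T] q_i,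
-- strictly for i₀; yet summed over all agents both sides agree, as every good is sold
-- out in both equilibria.
module Submission where

open import Defs
open import Data.Nat using (ℕ; zero; suc)
open import Data.Fin using (Fin; zero; suc)
open import Data.Fin.Properties using (any?)
open import Data.Rational using (ℚ; 0ℚ; _+_; _*_; _≤_; _<_; ∣_∣; positive; nonNegative)
open import Data.Rational.Properties
open import Data.Product using (_×_; _,_; proj₁; proj₂; ∃)
open import Data.Sum using (inj₁)
open import Data.Empty using (⊥)
open import Relation.Nullary using (¬_; Dec; yes; no; contradiction)
open import Relation.Nullary.Decidable using (¬?; _×-dec_; decidable-stable)
open import Relation.Binary.PropositionalEquality using (_≡_; _≢_; refl; sym; trans; cong; cong₂; subst; module ≡-Reasoning)
open import Algebra.Bundles using (CommutativeRing)
import Algebra.Properties.Semiring.Sum as SemiringSum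
import Algebra.Properties.CommutativeSemigroup as CommutativeSemigroupProperties
import Algebra.Properties.Group as GroupProperties

open CommutativeSemigroupProperties (CommutativeRing.*-commutativeSemigroup +-*-commutativeRing)
  using (x∙yz≈y∙xz; xy∙z≈z∙xy; x∙yz≈yx∙z; xy∙z≈y∙xz; x∙yz≈z∙yx)
open GroupProperties +-0-group using (x∙y⁻¹≈ε⇒x≈y)

*-pos : ∀ {x y} → 0ℚ < x → 0ℚ < y → 0ℚ < x * y
*-pos {x} {y} 0<x 0<y = positive⁻¹ _ {{pos*pos⇒pos x {{positive 0<x}} y {{positive 0<y}}}}

*-nonNeg : ∀ {x y} → 0ℚ ≤ x → 0ℚ ≤ y → 0ℚ ≤ x * y
*-nonNeg {x} {y} 0≤x 0≤y =
  nonNegative⁻¹ _ {{nonNeg*nonNeg⇒nonNeg x {{nonNegative 0≤x}} y {{nonNegative 0≤y}}}}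

≤∧≢⇒< : ∀ {x y} → x ≤ y → x ≢ y → x < y
≤∧≢⇒< {x} {y} x≤y x≢y = decidable-stable (x <? y) (λ x≮y → x≢y (≤-antisym x≤y (≮⇒≥ x≮y)))

module ΣQ = SemiringSum (CommutativeRing.semiring +-*-commutativeRing)

∑≡sum : ∀ {n} (g : Fin n → ℚ) → ∑ g ≡ ΣQ.sum g
∑≡sum {zero}  g = refl
∑≡sum {suc n} g = cong (g zero +_) (∑≡sum (λ k → g (suc k)))

∑-cong : ∀ {n} {g h : Fin n → ℚ} → (∀ k → g k ≡ h k) → ∑ g ≡ ∑ h
∑-cong {g = g} {h} g≗h = trans (∑≡sum g) (trans (ΣQ.sum-cong-≗ g≗h) (sym (∑≡sum h)))

∑-0 : ∀ n → ∑ {n} (λ _ → 0ℚ) ≡ 0ℚ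
∑-0 n = trans (∑≡sum {n} (λ _ → 0ℚ)) (ΣQ.sum-replicate-zero n)

∑-zero : ∀ {n} {g : Fin n → ℚ} → (∀ k → g k ≡ 0ℚ) → ∑ g ≡ 0ℚ
∑-zero {n} g≗0 = trans (∑-cong {h = λ _ → 0ℚ} g≗0) (∑-0 n)

*-distribˡ-∑ : ∀ {n} x (g : Fin n → ℚ) → x * ∑ g ≡ ∑ (λ k → x * g k)
*-distribˡ-∑ x g =
  trans (cong (x *_) (∑≡sum g)) (trans (ΣQ.*-distribˡ-sum x g) (sym (∑≡sum (λ k → x * g k))))

∑-linear : ∀ {n} α β (g h : Fin n → ℚ) → ∑ (λ k → α * g k + β * h k) ≡ α * ∑ g + β * ∑ h
∑-linear α β g h = begin
  ∑ (λ k → α * g k + β * h k)               ≡⟨ ∑≡sum (λ k → α * g k + β * h k) ⟩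
  ΣQ.sum (λ k → α * g k + β * h k)          ≡⟨ ΣQ.∑-distrib-+ (λ k → α * g k) (λ k → β * h k) ⟩
  ΣQ.sum (λ k → α * g k) + ΣQ.sum (λ k → β * h k)
    ≡⟨ cong₂ _+_ (∑≡sum (λ k → α * g k)) (∑≡sum (λ k → β * h k)) ⟨
  ∑ (λ k → α * g k) + ∑ (λ k → β * h k)     ≡⟨ cong₂ _+_ (*-distribˡ-∑ α g) (*-distribˡ-∑ β h) ⟨
  α * ∑ g + β * ∑ h                         ∎
  where open ≡-Reasoning

∑-comm : ∀ {m n} (h : Fin m → Fin n → ℚ) → ∑ (λ i → ∑ (h i)) ≡ ∑ (λ k → ∑ (λ i → h i k))
∑-comm h = begin
  ∑ (λ i → ∑ (h i))                   ≡⟨ ∑-cong (λ i → ∑≡sum (h i)) ⟩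
  ∑ (λ i → ΣQ.sum (h i))              ≡⟨ ∑≡sum (λ i → ΣQ.sum (h i)) ⟩
  ΣQ.sum (λ i → ΣQ.sum (h i))         ≡⟨ ΣQ.∑-comm h ⟩
  ΣQ.sum (λ k → ΣQ.sum (λ i → h i k)) ≡⟨ ∑≡sum (λ k → ΣQ.sum (λ i → h i k)) ⟨
  ∑ (λ k → ΣQ.sum (λ i → h i k))      ≡⟨ ∑-cong (λ k → ∑≡sum (λ i → h i k)) ⟨
  ∑ (λ k → ∑ (λ i → h i k))           ∎
  where open ≡-Reasoning

∑-mono-≤ : ∀ {n} {g h : Fin n → ℚ} → (∀ k → g k ≤ h k) → ∑ g ≤ ∑ h
∑-mono-≤ {zero}  g≤h = ≤-refl
∑-mono-≤ {suc n} g≤h = +-mono-≤ (g≤h zero) (∑-mono-≤ (λ k → g≤h (suc k)))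

∑-mono-< : ∀ {n} {g h : Fin n → ℚ} → (∀ k → g k ≤ h k) → ∀ k₀ → g k₀ < h k₀ → ∑ g < ∑ h
∑-mono-< g≤h zero     g<h = +-mono-<-≤ g<h (∑-mono-≤ (λ k → g≤h (suc k)))
∑-mono-< g≤h (suc k₀) g<h = +-mono-≤-< (g≤h zero) (∑-mono-< (λ k → g≤h (suc k)) k₀ g<h)

∑-nonNeg : ∀ {n} {g : Fin n → ℚ} → (∀ k → 0ℚ ≤ g k) → 0ℚ ≤ ∑ g
∑-nonNeg {n} {g} 0≤g = subst (_≤ ∑ g) (∑-0 n) (∑-mono-≤ 0≤g)

∑-pos : ∀ {n} {g : Fin n → ℚ} → (∀ k → 0ℚ ≤ g k) → ∀ k₀ → 0ℚ < g k₀ → 0ℚ < ∑ g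
∑-pos {n} 0≤g k₀ 0<g = <-respˡ-≡ (∑-0 n) (∑-mono-< 0≤g k₀ 0<g)

pointwise≤∧∑≡⇒≡ : ∀ {n} {g h : Fin n → ℚ} → (∀ k → g k ≤ h k) → ∑ g ≡ ∑ h → ∀ k → g k ≡ h k
pointwise≤∧∑≡⇒≡ g≤h ∑g≡∑h k =
  ≤-antisym (g≤h k) (≮⇒≥ (λ gk<hk → <-irrefl ∑g≡∑h (∑-mono-< g≤h k gk<hk)))

module FAllocation {n} {u : Utilities n} {F : EdgeSet n} {p : Prices n} {f : Flow n}
                   (alloc : IsFAllocation u F p f) where

  price-pos : ∀ j → 0ℚ < p j
  price-pos = proj₁ alloc

  flow-nonNeg : ∀ i j → ¬ F i j → 0ℚ ≤ f i j
  flow-nonNeg = proj₁ (proj₂ alloc)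

  supp⊆MBB : ∀ {i j} → f i j ≢ 0ℚ → MBB u p i j
  supp⊆MBB {i} {j} fij≢0 = proj₁ (proj₂ (proj₂ alloc)) i j (inj₁ fij≢0)

  spending≤budget : ∀ i → ∑ (λ j → f i j) ≤ p i
  spending≤budget = proj₁ (proj₂ (proj₂ (proj₂ alloc)))

module _ {n} {u : Utilities n} {F : EdgeSet n} {p : Prices n} {f : Flow n} where

  sold-out : IsFEquilibrium u F p f → ∀ j → ∑ (λ i → f i j) ≡ p j
  sold-out (_ , ∑∣s∣≡0) j = sym (x∙y⁻¹≈ε⇒x≈y (p j) (∑ (λ i → f i j)) (∣p∣≡0⇒p≡0 _ ∣sⱼ∣≡0))
    where
    ∣sⱼ∣≡0 : ∣ surplus p f j ∣ ≡ 0ℚ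
    ∣sⱼ∣≡0 = sym (pointwise≤∧∑≡⇒≡ (λ k → 0≤∣p∣ (surplus p f k))
                   (trans (∑-0 n) (sym ∑∣s∣≡0)) j)

  budget-spent : IsFEquilibrium u F p f → ∀ i → ∑ (λ j → f i j) ≡ p i
  budget-spent eq = pointwise≤∧∑≡⇒≡ (FAllocation.spending≤budget (proj₁ eq))
                      (trans (∑-comm f) (∑-cong (sold-out eq)))

-- q k / p k > c / a, cross-multiplied (prices are positive).
ExceedsRatio : ∀ {n} → Prices n → Prices n → ℚ → ℚ → Fin n → Set
ExceedsRatio p q c a k = c * p k < a * q k

MBB-preserves-ExceedsRatio : ∀ {n} {u : Utilities n} {p q : Prices n} {c a : ℚ} {i k m} →
  0ℚ ≤ c → 0ℚ ≤ a → MBB u q i k → MBB u p i m →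
  ExceedsRatio p q c a k → ExceedsRatio p q c a m
MBB-preserves-ExceedsRatio {u = u} {p} {q} {c} {a} {i} {k} {m}
  0≤c 0≤a (0<uik , k-best-at-q) (0<uim , m-best-at-p) k-exceeds =
  *-cancelˡ-<-nonNeg (u i k) {{nonNegative (<⇒≤ 0<uik)}} (begin-strict
    u i k * (c * p m) ≡⟨ x∙yz≈y∙xz (u i k) c (p m) ⟩
    c * (u i k * p m) ≤⟨ *-monoˡ-≤-nonNeg c {{nonNegative 0≤c}} (m-best-at-p k) ⟩
    c * (u i m * p k) ≡⟨ x∙yz≈y∙xz c (u i m) (p k) ⟩
    u i m * (c * p k) <⟨ *-monoʳ-<-pos (u i m) {{positive 0<uim}} k-exceeds ⟩
    u i m * (a * q k) ≡⟨ x∙yz≈y∙xz (u i m) a (q k) ⟩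
    a * (u i m * q k) ≤⟨ *-monoˡ-≤-nonNeg a {{nonNegative 0≤a}} (k-best-at-q m) ⟩
    a * (u i k * q m) ≡⟨ x∙yz≈y∙xz a (u i k) (q m) ⟩
    u i k * (a * q m) ∎)
  where open ≤-Reasoning

restrict : ∀ {P : Set} → Dec P → ℚ → ℚ
restrict (yes _) x = x
restrict (no _)  _ = 0ℚ

restrict-elim : ∀ {P : Set} (R : ℚ → Set) (d : Dec P) {x} → (P → R x) → (¬ P → R 0ℚ) → R (restrict d x)
restrict-elim R (yes p) holds _     = holds p
restrict-elim R (no ¬p) _     fails = fails ¬p

∑-restrict : ∀ {n} {P : Set} (d : Dec P) (g : Fin n → ℚ) →
             ∑ (λ k → restrict d (g k)) ≡ restrict d (∑ g)
∑-restrict     (yes _) g = refl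
∑-restrict {n} (no _)  g = ∑-0 n

module SpendingOn {n} {T : Fin n → Set} (T? : ∀ k → Dec (T k)) where

  spentOn : Flow n → Fin n → ℚ
  spentOn h i = ∑ (λ k → restrict (T? k) (h i k))

  ownIn : Prices n → Fin n → ℚ
  ownIn r i = restrict (T? i) (r i)

  ∑-spentOn : ∀ {u : Utilities n} {F r h} → IsFEquilibrium u F r h → ∑ (spentOn h) ≡ ∑ (ownIn r)
  ∑-spentOn {h = h} eq = trans (∑-comm (λ i k → restrict (T? k) (h i k)))
    (∑-cong (λ k → trans (∑-restrict (T? k) (λ i → h i k)) (cong (restrict (T? k)) (sold-out eq k))))

  spentOn≤spending : ∀ {h : Flow n} {i} → (∀ k → 0ℚ ≤ h i k) → spentOn h i ≤ ∑ (λ k → h i k)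
  spentOn≤spending {h} {i} 0≤h =
    ∑-mono-≤ (λ k → restrict-elim (_≤ h i k) (T? k) (λ _ → ≤-refl) (λ _ → 0≤h k))

module _ {n} {u : Utilities n} {F : EdgeSet n} {p q : Prices n} {f g : Flow n}
         (F-eq : IsFEquilibrium u F p f) (market-eq : IsMarketEquilibrium u q g)
         (F⊆MBB-at-q : ∀ i k → F i k → MBB u q i k) where

  open FAllocation (proj₁ F-eq)
  open FAllocation (proj₁ market-eq) using ()
    renaming (price-pos to q-pos; flow-nonNeg to g-nonNeg-off-∅; supp⊆MBB to g-supp⊆MBB;
              spending≤budget to g-spending≤budget)

  g-nonNeg : ∀ i k → 0ℚ ≤ g i k
  g-nonNeg i k = g-nonNeg-off-∅ i k (λ ())

  module Violation (i₀ j l : Fin n) (fi₀j≢0 : f i₀ j ≢ 0ℚ)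
                   (l-beats-j : u i₀ j * q l < u i₀ l * q j) where

    a c : ℚ
    a = u i₀ l * p j
    c = u i₀ j * q l

    T : Fin n → Set
    T = ExceedsRatio p q c a

    T? : ∀ k → Dec (T k)
    T? k = c * p k <? a * q k

    open SpendingOn T?

    j-MBB-at-p : MBB u p i₀ j
    j-MBB-at-p = supp⊆MBB fi₀j≢0

    0<c : 0ℚ < c
    0<c = *-pos (proj₁ j-MBB-at-p) (q-pos l)

    j∈T : T j
    j∈T = begin-strict
      c * p j              ≡⟨ xy∙z≈z∙xy (u i₀ j) (q l) (p j) ⟩
      p j * (u i₀ j * q l) <⟨ *-monoʳ-<-pos (p j) {{positive (price-pos j)}} l-beats-j ⟩
      p j * (u i₀ l * q j) ≡⟨ x∙yz≈yx∙z (p j) (u i₀ l) (q j) ⟩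
      a * q j              ∎
      where open ≤-Reasoning

    0≤a : 0ℚ ≤ a
    0≤a = <⇒≤ (*-cancelʳ-<-nonNeg (q j) {{nonNegative (<⇒≤ (q-pos j))}}
                (<-respˡ-≡ (sym (*-zeroˡ (q j)))
                  (≤-<-trans (*-nonNeg (<⇒≤ 0<c) (<⇒≤ (price-pos j))) j∈T)))

    i₀-MBB-at-q-∉T : ∀ {k} → MBB u q i₀ k → ¬ T k
    i₀-MBB-at-q-∉T {k} (_ , k-best-at-q) k∈T = <-irrefl refl (<-≤-trans k∈T aqₖ≤cpₖ)
      where
      open ≤-Reasoning
      aqₖ≤cpₖ : a * q k ≤ c * p k
      aqₖ≤cpₖ = begin
        a * q k              ≡⟨ xy∙z≈y∙xz (u i₀ l) (p j) (q k) ⟩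
        p j * (u i₀ l * q k) ≤⟨ *-monoˡ-≤-nonNeg (p j) {{nonNegative (<⇒≤ (price-pos j))}} (k-best-at-q l) ⟩
        p j * (u i₀ k * q l) ≡⟨ x∙yz≈z∙yx (p j) (u i₀ k) (q l) ⟩
        q l * (u i₀ k * p j) ≤⟨ *-monoˡ-≤-nonNeg (q l) {{nonNegative (<⇒≤ (q-pos l))}} (proj₂ j-MBB-at-p k) ⟩
        q l * (u i₀ j * p k) ≡⟨ x∙yz≈yx∙z (q l) (u i₀ j) (p k) ⟩
        c * p k              ∎

    LeaksOutOfT : Fin n → Set
    LeaksOutOfT i = ∃ λ m → ¬ T m × f i m ≢ 0ℚ

    leaksOutOfT? : ∀ i → Dec (LeaksOutOfT i)
    leaksOutOfT? i = any? (λ m → ¬? (T? m) ×-dec ¬? (f i m ≟ 0ℚ))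

    leaking-agent-MBB-at-q-∉T : ∀ {i} → LeaksOutOfT i → ∀ {k} → MBB u q i k → ¬ T k
    leaking-agent-MBB-at-q-∉T (m , m∉T , fim≢0) k-MBB k∈T =
      m∉T (MBB-preserves-ExceedsRatio {u = u} {p} {q} (<⇒≤ 0<c) 0≤a k-MBB (supp⊆MBB fim≢0) k∈T)

    leaking-agent-flow-nonNeg : ∀ {i} → LeaksOutOfT i → ∀ {k} → T k → 0ℚ ≤ f i k
    leaking-agent-flow-nonNeg {i} leak {k} k∈T =
      flow-nonNeg i k (λ Fik → leaking-agent-MBB-at-q-∉T leak (F⊆MBB-at-q i k Fik) k∈T)

    leaking-agent-pays-for-T : ∀ {i} → LeaksOutOfT i → ∀ k → 0ℚ ≤ restrict (T? k) (f i k)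
    leaking-agent-pays-for-T leak k =
      restrict-elim (0ℚ ≤_) (T? k) (leaking-agent-flow-nonNeg leak) (λ _ → ≤-refl)

    no-demand-in-T : ∀ {i} → (∀ {k} → MBB u q i k → ¬ T k) → spentOn g i ≡ 0ℚ
    no-demand-in-T {i} MBB-∉T = ∑-zero (λ k → restrict-elim (_≡ 0ℚ) (T? k) (gik≡0 k) (λ _ → refl))
      where
      gik≡0 : ∀ k → T k → g i k ≡ 0ℚ
      gik≡0 k k∈T = decidable-stable (g i k ≟ 0ℚ) (λ gik≢0 → MBB-∉T (g-supp⊆MBB gik≢0) k∈T)

    sealed-agent-spentOn : ∀ {i} → ¬ LeaksOutOfT i → spentOn f i ≡ p i
    sealed-agent-spentOn {i} sealed = trans (∑-cong restricted≡) (budget-spent F-eq i)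
      where
      restricted≡ : ∀ k → restrict (T? k) (f i k) ≡ f i k
      restricted≡ k = restrict-elim (_≡ f i k) (T? k) (λ _ → refl)
        (λ k∉T → sym (decidable-stable (f i k ≟ 0ℚ) (λ fik≢0 → sealed (k , k∉T , fik≢0))))

    spentOn≤budget : ∀ i → spentOn g i ≤ q i
    spentOn≤budget i = ≤-trans (spentOn≤spending {g} (g-nonNeg i)) (g-spending≤budget i)

    ownIn-ratio : ∀ {i} (d : Dec (T i)) → c * restrict d (p i) ≤ a * restrict d (q i)
    ownIn-ratio (yes i∈T) = <⇒≤ i∈T
    ownIn-ratio (no _)    = ≤-reflexive (trans (*-zeroʳ c) (sym (*-zeroʳ a)))

    ownIn-budget : ∀ {i} (d : Dec (T i)) →
                   a * q i + c * restrict d (p i) ≤ c * p i + a * restrict d (q i)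
    ownIn-budget {i} (yes _) = ≤-reflexive (+-comm (a * q i) (c * p i))
    ownIn-budget {i} (no i∉T)
      rewrite *-zeroʳ c | *-zeroʳ a | +-identityʳ (a * q i) | +-identityʳ (c * p i) = ≮⇒≥ i∉T

    g-side f-side : Fin n → ℚ
    g-side i = a * spentOn g i + c * ownIn p i
    f-side i = c * spentOn f i + a * ownIn q i

    idle-agent-g-side : ∀ {i} → spentOn g i ≡ 0ℚ → g-side i ≡ 0ℚ + c * ownIn p i
    idle-agent-g-side {i} idle =
      trans (cong (λ z → a * z + c * ownIn p i) idle) (cong (_+ c * ownIn p i) (*-zeroʳ a))

    agent-balance : ∀ i → g-side i ≤ f-side i
    agent-balance i with leaksOutOfT? i
    ... | yes leak = begin
      g-side i                   ≡⟨ idle-agent-g-side (no-demand-in-T (leaking-agent-MBB-at-q-∉T leak)) ⟩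
      0ℚ + c * ownIn p i         ≤⟨ +-mono-≤ (*-nonNeg (<⇒≤ 0<c) (∑-nonNeg (leaking-agent-pays-for-T leak)))
                                             (ownIn-ratio (T? i)) ⟩
      f-side i                   ∎
      where open ≤-Reasoning
    ... | no sealed = begin
      g-side i                   ≤⟨ +-monoˡ-≤ (c * ownIn p i) (*-monoˡ-≤-nonNeg a {{nonNegative 0≤a}} (spentOn≤budget i)) ⟩
      a * q i + c * ownIn p i    ≤⟨ ownIn-budget (T? i) ⟩
      c * p i + a * ownIn q i    ≡⟨ cong (λ z → c * z + a * ownIn q i) (sealed-agent-spentOn sealed) ⟨
      f-side i                   ∎
      where open ≤-Reasoning

    i₀-pays-for-T : 0ℚ < spentOn f i₀
    i₀-pays-for-T with leaksOutOfT? i₀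
    ... | yes leak =
      ∑-pos (leaking-agent-pays-for-T leak) j
            (restrict-elim (0ℚ <_) (T? j) (λ _ → 0<fi₀j) (contradiction j∈T))
      where
      0<fi₀j : 0ℚ < f i₀ j
      0<fi₀j = ≤∧≢⇒< (leaking-agent-flow-nonNeg leak j∈T) (λ 0≡fi₀j → fi₀j≢0 (sym 0≡fi₀j))
    ... | no sealed = <-respʳ-≡ (sym (sealed-agent-spentOn sealed)) (price-pos i₀)

    i₀-balance : g-side i₀ < f-side i₀
    i₀-balance = begin-strict
      g-side i₀                  ≡⟨ idle-agent-g-side (no-demand-in-T i₀-MBB-at-q-∉T) ⟩
      0ℚ + c * ownIn p i₀        <⟨ +-mono-<-≤ (*-pos 0<c i₀-pays-for-T) (ownIn-ratio (T? i₀)) ⟩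
      f-side i₀                  ∎
      where open ≤-Reasoning

    ∑-sides : ∑ g-side ≡ ∑ f-side
    ∑-sides = begin
      ∑ g-side                              ≡⟨ ∑-linear a c (spentOn g) (ownIn p) ⟩
      a * ∑ (spentOn g) + c * ∑ (ownIn p)   ≡⟨ cong (λ z → a * z + c * ∑ (ownIn p)) (∑-spentOn market-eq) ⟩
      a * ∑ (ownIn q) + c * ∑ (ownIn p)     ≡⟨ +-comm (a * ∑ (ownIn q)) (c * ∑ (ownIn p)) ⟩
      c * ∑ (ownIn p) + a * ∑ (ownIn q)     ≡⟨ cong (λ z → c * z + a * ∑ (ownIn q)) (∑-spentOn F-eq) ⟨
      c * ∑ (spentOn f) + a * ∑ (ownIn q)   ≡⟨ ∑-linear c a (spentOn f) (ownIn q) ⟨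
      ∑ f-side                              ∎
      where open ≡-Reasoning

    absurd : ⊥
    absurd = <-irrefl ∑-sides (∑-mono-< agent-balance i₀ i₀-balance)

  supp⊆MBB-at-q : ∀ {i j} → f i j ≢ 0ℚ → MBB u q i j
  supp⊆MBB-at-q {i} {j} fij≢0 =
    proj₁ (supp⊆MBB fij≢0) , λ l → ≮⇒≥ (Violation.absurd i j l fij≢0)

corollary4p1 : (n : ℕ) (u : Utilities n) → (∀ i j → 0ℚ ≤ u i j) →
    (F : EdgeSet n) → (∀ i j → F i j → FStar u i j) →
    (p : Prices n) (f : Flow n) → IsFEquilibrium u F p f →
    ∀ i j → f i j ≢ 0ℚ → FStar u i j
corollary4p1 _ _ _ _ F⊆F* _ _ F-eq i j fij≢0 =
  proj₁ (FAllocation.supp⊆MBB (proj₁ F-eq) fij≢0) ,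
  λ q g market-eq → supp⊆MBB-at-q F-eq market-eq (λ i k Fik → proj₂ (F⊆F* i k Fik) q g market-eq) fij≢0
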